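{- Let $\mathcal S$ be a schema and let $\mathbb V_x=\{x_1,\dots,x_n\}$ be a set of $n$ variables, with a disjoint copy $\mathbb V_y=\{y_1,\dots,y_n\}$. For every FLIF expression $\alpha$ over $\mathcal S$ and $\mathbb V_x$ there exists a $\mathbb V_x$-executable FO formula $\varphi_\alpha$ over $\mathcal S$ using at most $3n$ distinct variables (free or bound), with free variables in $\mathbb V_x\cup\mathbb V_y$, such that for every instance $D$ and all $\mathbb V_x$-valuations $\nu_1,\nu_2$: \[(\nu_1,\nu_2)\in[\![\alpha]\!]^{\mathbb V_x}_D \iff D,(\nu_1\cup\nu_2')\models\varphi_\alpha,\] where $\nu_2'$ is the $\mathbb V_y$-valuation with $\nu_2'(y_i)=\nu_2(x_i)$ for $i=1,\dots,n$.
   Context: Fix a countably infinite set $\mathbf{dom}$ of constants. A database schema $\mathcal S$ is a finite set of relation names $R$, each with an arity $\mathrm{ar}(R)$ and an input arity $\mathrm{iar}(R)\le\mathrm{ar}(R)$; $\mathrm{oar}(R)=\mathrm{ar}(R)-\mathrm{iar}(R)$. An instance $D$ assigns to each $R$ a relation $D(R)\subseteq\mathbf{dom}^{\mathrm{ar}(R)}$. An $X$-valuation is a map $X\to\mathbf{dom}$; $\nu(c)=c$ for constants; $\nu[x:=c]$ is $\nu$ changed at $x$. FLIF expressions over $\mathcal S$ and a variable set $\mathbb V$: atomic expressions $R(\bar x;\bar y)$ ($\bar x$ of length $\mathrm{iar}(R)$, $\bar y$ of length $\mathrm{oar}(R)$, variables from $\mathbb V$), $(x=y)$, $(x=c)$,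 $(x:=y)$, $(x:=c)$; closed under $;$, $\cup$, $-$. Semantics $[\![\alpha]\!]^{\mathbb V}_D$ (a set of pairs of $\mathbb V$-valuations): $R(\bar x;\bar y)$: $(\nu_1,\nu_2)$ with $\nu_1(\bar x)\cdot\nu_2(\bar y)\in D(R)$ and $\nu_1,\nu_2$ agreeing on variables not in $\bar y$; $(x=y)$: $(\nu,\nu)$ with $\nu(x)=\nu(y)$; $(x=c)$: $(\nu,\nu)$ with $\nu(x)=c$; $(x:=y)$: $(\nu,\nu[x:=\nu(y)])$; $(x:=c)$: $(\nu,\nu[x:=c])$; $;$ is composition of binary relations, $\cup,-$ are union and difference. FO formulas over $\mathcal S$: relation atoms $R(\bar x;\bar y)$, equalities $x=y$, $x=c$, and $\neg,\wedge,\vee,\exists$, with natural semantics over $\mathbf{dom}$. $V$-executability: $x=y$ if $x\in V$ or $y\in V$; $x=c$ always; $R(\bar x;\bar y)$ if the variables of $\bar x$ are in $V$; $\neg\varphi$ if $\varphi$ is and $\mathrm{FV}(\varphi)\subseteq V$; $\varphi\wedge\psi$ if $\varphi$ is $V$-executable and $\psi$ is $(V\cup\mathrm{FV}(\varphi))$-executable; $\varphi\vee\psi$ if both are $V$-executable and $\mathrm{FV}(\varphi)\triangle\mathrm{FV}(\psi)\subseteq V$; $\exists x\,\varphi$ if $\varphi$ is $(V\setminus\{x\})$-executable. -}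

module Defs where

open import Data.Nat using (ℕ; _+_; _≤_)
open import Data.Fin using (Fin)
open import Data.Vec using (Vec; lookup; map; _++_; _[_]≔_)
open import Data.Vec.Membership.Propositional using (_∈_; _∉_)
open import Data.List using (List; length)
import Data.List.Membership.Propositional as L
open import Data.Product using (Σ; _×_)
open import Data.Sum using (_⊎_)
open import Data.Unit using (⊤)
open import Data.Empty using (⊥)
open import Relation.Nullary using (¬_)
open import Relation.Binary.PropositionalEquality using (_≡_; _≢_)

Dom : Set
Dom = ℕ

record Schema : Set where
  field
    size : ℕ
    iar  : Fin size → ℕ
    oar  : Fin size → ℕ
  ar : Fin size → ℕ
  ar R = iar R + oar R
open Schema public

Instance : Schema → Set₁
Instance S = (R : Fin (size S)) → Vec Dom (ar S R) → Set

-- FLIF over the variable set V_x = {x_1..x_n}, represented by Fin n.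
-- A V_x-valuation is a vector Vec Dom n.

Val : ℕ → Set
Val n = Vec Dom n

data FLIF (S : Schema) (n : ℕ) : Set where
  rel   : (R : Fin (size S)) → Vec (Fin n) (iar S R) → Vec (Fin n) (oar S R) → FLIF S n
  eqv   : Fin n → Fin n → FLIF S n
  eqc   : Fin n → Dom → FLIF S n
  asgv  : Fin n → Fin n → FLIF S n
  asgc  : Fin n → Dom → FLIF S n
  _⨾_   : FLIF S n → FLIF S n → FLIF S n
  _∪_   : FLIF S n → FLIF S n → FLIF S n
  _─_   : FLIF S n → FLIF S n → FLIF S n

⟦_⟧ : ∀ {S n} → FLIF S n → Instance S → Val n → Val n → Set
⟦ rel R xs ys ⟧ D ν₁ ν₂ =
  D R (map (lookup ν₁) xs ++ map (lookup ν₂) ys) ×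
  (∀ v → v ∉ ys → lookup ν₁ v ≡ lookup ν₂ v)
⟦ eqv x y ⟧  D ν₁ ν₂ = ν₁ ≡ ν₂ × lookup ν₁ x ≡ lookup ν₁ y
⟦ eqc x c ⟧  D ν₁ ν₂ = ν₁ ≡ ν₂ × lookup ν₁ x ≡ c
⟦ asgv x y ⟧ D ν₁ ν₂ = ν₂ ≡ ν₁ [ x ]≔ lookup ν₁ y
⟦ asgc x c ⟧ D ν₁ ν₂ = ν₂ ≡ ν₁ [ x ]≔ c
⟦ α ⨾ β ⟧    D ν₁ ν₂ = Σ (Val _) λ ν → ⟦ α ⟧ D ν₁ ν × ⟦ β ⟧ D ν ν₂
⟦ α ∪ β ⟧    D ν₁ ν₂ = ⟦ α ⟧ D ν₁ ν₂ ⊎ ⟦ β ⟧ D ν₁ ν₂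
⟦ α ─ β ⟧    D ν₁ ν₂ = ⟦ α ⟧ D ν₁ ν₂ × ¬ ⟦ β ⟧ D ν₁ ν₂

-- FO variables: x_i (i < n), the copy y_i (i < n), and further variables z_k.

data Var (n : ℕ) : Set where
  xv : Fin n → Var n
  yv : Fin n → Var n
  zv : ℕ → Var n

IsX : ∀ {n} → Var n → Set
IsX (xv _) = ⊤
IsX (yv _) = ⊥
IsX (zv _) = ⊥

IsXY : ∀ {n} → Var n → Set
IsXY (xv _) = ⊤
IsXY (yv _) = ⊤
IsXY (zv _) = ⊥

data Formula (S : Schema) (n : ℕ) : Set where
  rel  : (R : Fin (size S)) → Vec (Var n) (iar S R) → Vec (Var n) (oar S R) → Formula S n
  eqv  : Var n → Var n → Formula S n
  eqc  : Var n → Dom → Formula S n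
  ¬'   : Formula S n → Formula S n
  _∧'_ : Formula S n → Formula S n → Formula S n
  _∨'_ : Formula S n → Formula S n → Formula S n
  ∃'   : Var n → Formula S n → Formula S n

Free : ∀ {S n} → Var n → Formula S n → Set
Free v (rel R xs ys) = v ∈ xs ⊎ v ∈ ys
Free v (eqv x y)     = v ≡ x ⊎ v ≡ y
Free v (eqc x c)     = v ≡ x
Free v (¬' φ)        = Free v φ
Free v (φ ∧' ψ)      = Free v φ ⊎ Free v ψ
Free v (φ ∨' ψ)      = Free v φ ⊎ Free v ψ
Free v (∃' x φ)      = Free v φ × v ≢ x

Occ : ∀ {S n} → Var n → Formula S n → Set
Occ v (rel R xs ys) = v ∈ xs ⊎ v ∈ ys
Occ v (eqv x y)     = v ≡ x ⊎ v ≡ y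
Occ v (eqc x c)     = v ≡ x
Occ v (¬' φ)        = Occ v φ
Occ v (φ ∧' ψ)      = Occ v φ ⊎ Occ v ψ
Occ v (φ ∨' ψ)      = Occ v φ ⊎ Occ v ψ
Occ v (∃' x φ)      = Occ v φ ⊎ v ≡ x

UsesAtMost : ∀ {S n} → ℕ → Formula S n → Set
UsesAtMost {n = n} k φ =
  Σ (List (Var n)) λ L → length L ≤ k × (∀ v → Occ v φ → v L.∈ L)

Exec : ∀ {S n} → (Var n → Set) → Formula S n → Set
Exec W (rel R xs ys) = ∀ v → v ∈ xs → W v
Exec W (eqv x y)     = W x ⊎ W y
Exec W (eqc x c)     = ⊤
Exec W (¬' φ)        = Exec W φ × (∀ v → Free v φ → W v)
Exec W (φ ∧' ψ)      = Exec W φ × Exec (λ v → W v ⊎ Free v φ) ψ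
Exec W (φ ∨' ψ)      = Exec W φ × Exec W ψ ×
                       (∀ v → Free v φ → ¬ Free v ψ → W v) ×
                       (∀ v → Free v ψ → ¬ Free v φ → W v)
Exec W (∃' x φ)      = Exec (λ v → W v × v ≢ x) φ

Sat : ∀ {S n} → Instance S → (Var n → Dom) → Formula S n → Set
Sat D σ (rel R xs ys) = D R (map σ xs ++ map σ ys)
Sat D σ (eqv x y)     = σ x ≡ σ y
Sat D σ (eqc x c)     = σ x ≡ c
Sat D σ (¬' φ)        = ¬ Sat D σ φ
Sat D σ (φ ∧' ψ)      = Sat D σ φ × Sat D σ ψ
Sat D σ (φ ∨' ψ)      = Sat D σ φ ⊎ Sat D σ ψ
Sat {n = n} D σ (∃' x φ) =
  Σ (Var n → Dom) λ σ' → (∀ v → v ≢ x → σ' v ≡ σ v) × Sat D σ' φ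

-- Translate relative to an input register r and an output register s of n variables
-- each (the x's, the y's, and the z_k with k < n); φ_α is the translation from x to y.
-- An atom becomes its condition on the two registers conjoined with equalities copying
-- every input it does not write into the output; ∪ and − become ∨ and ∧¬; and α ; β
-- from r to s becomes ∃ m (α from r to m ∧ β from m to s) for the third register m, so
-- composition reuses the same 3n variables.  Every output variable is free in every
-- translation, which is what makes ∨, ¬ and the second conjunct of a composition
-- executable.
module Submission where

open import Defs
open import Data.Nat using (ℕ; _*_; _+_; _<?_) renaming (_≟_ to _≟ℕ_)
open import Data.Nat.Properties using (+-identityʳ; ≤-reflexive)
open import Data.Fin using (Fin; toℕ; fromℕ<; _≟_)
open import Data.Fin.Properties using (toℕ-injective; toℕ-fromℕ<; toℕ<n)
open import Data.Vec as V using (lookup; tabulate; _[_]≔_)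
open import Data.Vec.Properties using (map-cong; map-∘; lookup∘update; lookup∘update′; lookup∘tabulate; tabulate∘lookup; tabulate-cong)
open import Data.Vec.Membership.Propositional using (_∈_)
open import Data.Vec.Membership.Propositional.Properties using (∈-map⁺)
open import Data.Vec.Relation.Unary.Any using (satisfied)
open import Data.Vec.Relation.Unary.Any.Properties using (map⁻)
import Data.Vec.Membership.DecPropositional as VecDec
open import Data.List as List using (List; []; _∷_; _++_; filter; allFin)
open import Data.List.Properties using (length-++; length-tabulate)
import Data.List.Membership.Propositional as L
open import Data.List.Membership.Propositional.Properties using (∈-tabulate⁺; ∈-tabulate⁻; ∈-filter⁺; ∈-filter⁻; ∈-allFin; ∈-++⁺ˡ; ∈-++⁺ʳ)
open import Data.List.Relation.Unary.All as All using (All; []; _∷_)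
open import Data.List.Relation.Unary.Any using (here; there)
open import Data.Product as Product using (Σ; ∃; _×_; _,_; proj₁; proj₂; uncurry)
open import Data.Product.Function.NonDependent.Propositional using (_×-⇔_)
open import Data.Sum as Sum using (_⊎_; inj₁; inj₂; [_,_]′)
open import Data.Sum.Function.Propositional using (_⊎-⇔_)
open import Data.Unit using (tt)
open import Data.Empty using (⊥-elim)
open import Function.Base using (_∘_; id)
open import Function.Bundles using (_⇔_; mk⇔; Equivalence)
open import Function.Properties.Equivalence using () renaming (refl to ⇔-refl; sym to ⇔-sym; trans to ⇔-trans)
open import Function.Related.TypeIsomorphisms using (¬-cong-⇔)
open import Relation.Binary.Definitions using (DecidableEquality)
open import Relation.Binary.PropositionalEquality using (_≡_; _≢_; refl; sym; trans; cong; cong₂; subst; module ≡-Reasoning)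
open import Relation.Nullary using (¬_; Dec; yes; no)
open import Level using (0ℓ)
open import Relation.Unary using (Pred; Decidable; ∅)
open import Relation.Unary.Properties using (∅?; ∁?)

open Equivalence using (to; from)

≡⇔≡ : ∀ {A : Set} {a a′ b b′ : A} → a ≡ a′ → b ≡ b′ → (a ≡ b) ⇔ (a′ ≡ b′)
≡⇔≡ a≡a′ b≡b′ =
  mk⇔ (λ e → trans (sym a≡a′) (trans e b≡b′)) (λ e → trans a≡a′ (trans e (sym b≡b′)))

map-∘-cong : ∀ {A B C : Set} {g : B → C} {f : A → B} {h : A → C} {k} →
  (∀ a → g (f a) ≡ h a) → (xs : V.Vec A k) → V.map g (V.map f xs) ≡ V.map h xs
map-∘-cong {g = g} {f} g∘f≗h xs = trans (sym (map-∘ g f xs)) (map-cong g∘f≗h xs)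

module _ {n : ℕ} where

  Unchanged : Pred (Fin n) 0ℓ → Val n → Val n → Set
  Unchanged P ν₁ ν₂ = ∀ i → ¬ P i → lookup ν₁ i ≡ lookup ν₂ i

  All-filter-∁-allFin : ∀ {P Q : Pred (Fin n) 0ℓ} (P? : Decidable P) →
    All Q (filter (∁? P?) (allFin n)) ⇔ (∀ i → ¬ P i → Q i)
  All-filter-∁-allFin P? = mk⇔
    (λ qs i ¬p → All.lookup qs (∈-filter⁺ (∁? P?) (∈-allFin i) ¬p))
    (λ h → All.tabulate λ {i} i∈ → h i (proj₂ (∈-filter⁻ (∁? P?) {xs = allFin n} i∈)))

  ≡×⇔×Unchanged-∅ : {ν₁ ν₂ : Val n} {A : Set} → (ν₁ ≡ ν₂ × A) ⇔ (A × Unchanged ∅ ν₁ ν₂)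
  ≡×⇔×Unchanged-∅ {ν₁} {ν₂} = mk⇔
    (λ { (refl , a) → a , λ _ _ → refl })
    (λ (a , h) → pointwise h , a)
    where
    pointwise : Unchanged ∅ ν₁ ν₂ → ν₁ ≡ ν₂
    pointwise h = trans (sym (tabulate∘lookup ν₁))
      (trans (tabulate-cong (λ i → h i (λ ()))) (tabulate∘lookup ν₂))

  ≡-update⇔ : ∀ {ν₁ ν₂ : Val n} {x a} →
    ν₂ ≡ ν₁ [ x ]≔ a ⇔ (lookup ν₂ x ≡ a × Unchanged (_≡ x) ν₁ ν₂)
  ≡-update⇔ {ν₁} {ν₂} {x} {a} = mk⇔
    (λ { refl → lookup∘update x ν₁ a , λ i i≢x → sym (lookup∘update′ i≢x ν₁ a) })
    (λ { (ν₂x≡a , h) → trans (sym (tabulate∘lookup ν₂))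
           (trans (tabulate-cong (pointwise ν₂x≡a h)) (tabulate∘lookup (ν₁ [ x ]≔ a))) })
    where
    pointwise : lookup ν₂ x ≡ a → Unchanged (_≡ x) ν₁ ν₂ → ∀ i → lookup ν₂ i ≡ lookup (ν₁ [ x ]≔ a) i
    pointwise ν₂x≡a h i with i ≟ x
    ... | yes refl = trans ν₂x≡a (sym (lookup∘update x ν₁ a))
    ... | no i≢x = trans (sym (h i i≢x)) (sym (lookup∘update′ i≢x ν₁ a))

  _≟ᵛ_ : DecidableEquality (Var n)
  xv i ≟ᵛ xv j with i ≟ j
  ... | yes refl = yes refl
  ... | no i≢j = no λ { refl → i≢j refl }
  yv i ≟ᵛ yv j with i ≟ j
  ... | yes refl = yes refl
  ... | no i≢j = no λ { refl → i≢j refl }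
  zv k ≟ᵛ zv l with k ≟ℕ l
  ... | yes refl = yes refl
  ... | no k≢l = no λ { refl → k≢l refl }
  xv _ ≟ᵛ yv _ = no λ ()
  xv _ ≟ᵛ zv _ = no λ ()
  yv _ ≟ᵛ xv _ = no λ ()
  yv _ ≟ᵛ zv _ = no λ ()
  zv _ ≟ᵛ xv _ = no λ ()
  zv _ ≟ᵛ yv _ = no λ ()

data Reg : Set where
  X Y Z : Reg

other : Reg → Reg → Reg
other X X = Y
other X Y = Z
other X Z = Y
other Y X = Z
other Y Y = X
other Y Z = X
other Z X = Y
other Z Y = X
other Z Z = X

other-fresh : ∀ r s → other r s ≢ r × other r s ≢ s
other-fresh X X = (λ ()) , (λ ())
other-fresh X Y = (λ ()) , (λ ())
other-fresh X Z = (λ ()) , (λ ())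
other-fresh Y X = (λ ()) , (λ ())
other-fresh Y Y = (λ ()) , (λ ())
other-fresh Y Z = (λ ()) , (λ ())
other-fresh Z X = (λ ()) , (λ ())
other-fresh Z Y = (λ ()) , (λ ())
other-fresh Z Z = (λ ()) , (λ ())

module _ {n : ℕ} where

  reg : Reg → Fin n → Var n
  reg X = xv
  reg Y = yv
  reg Z = zv ∘ toℕ

  infix 4 _∈ʳ_ _∈ʳ?_

  _∈ʳ_ : Var n → Reg → Set
  v ∈ʳ r = ∃ λ i → v ≡ reg r i

  RegVar : Var n → Set
  RegVar v = ∃ λ r → v ∈ʳ r

  reg-injective : ∀ r {i j} → reg r i ≡ reg r j → i ≡ j
  reg-injective X refl = refl
  reg-injective Y refl = refl
  reg-injective Z eq = toℕ-injective (cong (λ { (zv k) → k ; _ → 0 }) eq)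

  reg-disjoint : ∀ r s {i j} → reg r i ≡ reg s j → r ≡ s
  reg-disjoint X X _ = refl
  reg-disjoint Y Y _ = refl
  reg-disjoint Z Z _ = refl
  reg-disjoint X Y ()
  reg-disjoint X Z ()
  reg-disjoint Y X ()
  reg-disjoint Y Z ()
  reg-disjoint Z X ()
  reg-disjoint Z Y ()

  ∈ʳ-disjoint : ∀ {v r s} → v ∈ʳ r → v ∈ʳ s → r ≡ s
  ∈ʳ-disjoint {r = r} {s} (i , refl) (j , eq) = reg-disjoint r s eq

  _∈ʳ?_ : ∀ v r → Dec (v ∈ʳ r)
  xv i ∈ʳ? X = yes (i , refl)
  yv i ∈ʳ? Y = yes (i , refl)
  zv k ∈ʳ? Z with k <? n
  ... | yes k<n = yes (fromℕ< k<n , cong zv (sym (toℕ-fromℕ< k<n)))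
  ... | no k≮n = no λ { (i , refl) → k≮n (toℕ<n i) }
  xv _ ∈ʳ? Y = no λ ()
  xv _ ∈ʳ? Z = no λ ()
  yv _ ∈ʳ? X = no λ ()
  yv _ ∈ʳ? Z = no λ ()
  zv _ ∈ʳ? X = no λ ()
  zv _ ∈ʳ? Y = no λ ()

  ∉ʳ-other : ∀ {v m t} → m ≢ t → v ∈ʳ t → ¬ v ∈ʳ m
  ∉ʳ-other m≢t ∈t ∈m = m≢t (∈ʳ-disjoint ∈m ∈t)

  ∈-map-reg : ∀ r {k v} {is : V.Vec (Fin n) k} → v ∈ V.map (reg r) is → v ∈ʳ r
  ∈-map-reg r = satisfied ∘ map⁻

  overwrite : Reg → Val n → (Var n → Dom) → Var n → Dom
  overwrite m ν σ v with v ∈ʳ? m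
  ... | yes (i , _) = lookup ν i
  ... | no _ = σ v

  overwrite-reg : ∀ m ν σ i → overwrite m ν σ (reg m i) ≡ lookup ν i
  overwrite-reg m ν σ i with reg m i ∈ʳ? m
  ... | yes (j , eq) = cong (lookup ν) (sym (reg-injective m eq))
  ... | no ∉m = ⊥-elim (∉m (i , refl))

  overwrite-other : ∀ m ν σ {v} → ¬ v ∈ʳ m → overwrite m ν σ v ≡ σ v
  overwrite-other m ν σ {v} ∉m with v ∈ʳ? m
  ... | yes ∈m = ⊥-elim (∉m ∈m)
  ... | no _ = refl

  block : Reg → List (Var n)
  block r = List.tabulate (reg r)

  ∈-block⁺ : ∀ r {v} → v ∈ʳ r → v L.∈ block r
  ∈-block⁺ r (i , refl) = ∈-tabulate⁺ i

  ∉-block : ∀ {v m t} → m ≢ t → v ∈ʳ t → v L.∉ block m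
  ∉-block m≢t ∈t = ∉ʳ-other m≢t ∈t ∘ ∈-tabulate⁻

  regVars : List (Var n)
  regVars = block X ++ block Y ++ block Z

  length-regVars : List.length regVars ≡ 3 * n
  length-regVars = begin
    List.length (block X ++ block Y ++ block Z)
      ≡⟨ length-++ (block X) ⟩
    List.length (block X) + List.length (block Y ++ block Z)
      ≡⟨ cong (List.length (block X) +_) (length-++ (block Y)) ⟩
    List.length (block X) + (List.length (block Y) + List.length (block Z))
      ≡⟨ cong₂ _+_ (length-tabulate (reg X)) (cong₂ _+_ (length-tabulate (reg Y)) (length-tabulate (reg Z))) ⟩
    n + (n + n)
      ≡⟨ cong (λ k → n + (n + k)) (sym (+-identityʳ n)) ⟩
    3 * n ∎
    where open ≡-Reasoning

  ∈-regVars : ∀ {v} → RegVar v → v L.∈ regVars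
  ∈-regVars (X , i , refl) = ∈-++⁺ˡ (∈-tabulate⁺ i)
  ∈-regVars (Y , i , refl) = ∈-++⁺ʳ (block X) (∈-++⁺ˡ (∈-tabulate⁺ i))
  ∈-regVars (Z , i , refl) = ∈-++⁺ʳ (block X) (∈-++⁺ʳ (block Y) (∈-tabulate⁺ i))

module _ {S : Schema} {n : ℕ} where

  open VecDec (_≟_ {n}) using (_∈?_)

  Fm : Set
  Fm = Formula S n

  Exec-mono : ∀ {V W : Var n → Set} → (∀ v → V v → W v) → ∀ (φ : Fm) → Exec V φ → Exec W φ
  Exec-mono V⊆W (rel R xs ys) e v p = V⊆W v (e v p)
  Exec-mono V⊆W (eqv x y) (inj₁ w) = inj₁ (V⊆W x w)
  Exec-mono V⊆W (eqv x y) (inj₂ w) = inj₂ (V⊆W y w)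
  Exec-mono V⊆W (eqc x c) e = tt
  Exec-mono V⊆W (¬' φ) (e , fv) = Exec-mono V⊆W φ e , λ v f → V⊆W v (fv v f)
  Exec-mono V⊆W (φ ∧' ψ) (e₁ , e₂) =
    Exec-mono V⊆W φ e₁ , Exec-mono (λ v → Sum.map₁ (V⊆W v)) ψ e₂
  Exec-mono V⊆W (φ ∨' ψ) (e₁ , e₂ , s₁ , s₂) =
    Exec-mono V⊆W φ e₁ , Exec-mono V⊆W ψ e₂ , (λ v f nf → V⊆W v (s₁ v f nf)) , (λ v f nf → V⊆W v (s₂ v f nf))
  Exec-mono V⊆W (∃' x φ) e = Exec-mono (λ v → Product.map₁ (V⊆W v)) φ e

  Sat-cong : ∀ {D : Instance S} {σ σ′ : Var n → Dom} → (∀ v → σ v ≡ σ′ v) → ∀ (φ : Fm) → Sat D σ φ → Sat D σ′ φ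
  Sat-cong {D} σ≗σ′ (rel R xs ys) s = subst (D R) (cong₂ V._++_ (map-cong σ≗σ′ xs) (map-cong σ≗σ′ ys)) s
  Sat-cong σ≗σ′ (eqv x y) s = trans (sym (σ≗σ′ x)) (trans s (σ≗σ′ y))
  Sat-cong σ≗σ′ (eqc x c) s = trans (sym (σ≗σ′ x)) s
  Sat-cong σ≗σ′ (¬' φ) ¬s s′ = ¬s (Sat-cong (sym ∘ σ≗σ′) φ s′)
  Sat-cong σ≗σ′ (φ ∧' ψ) (s₁ , s₂) = Sat-cong σ≗σ′ φ s₁ , Sat-cong σ≗σ′ ψ s₂
  Sat-cong σ≗σ′ (φ ∨' ψ) (inj₁ s) = inj₁ (Sat-cong σ≗σ′ φ s)
  Sat-cong σ≗σ′ (φ ∨' ψ) (inj₂ s) = inj₂ (Sat-cong σ≗σ′ ψ s)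
  Sat-cong σ≗σ′ (∃' x φ) (τ , agree , s) = τ , (λ v v≢x → trans (agree v v≢x) (σ≗σ′ v)) , s

  ∃'⋆ : List (Var n) → Fm → Fm
  ∃'⋆ []       φ = φ
  ∃'⋆ (x ∷ xs) φ = ∃' x (∃'⋆ xs φ)

  module _ {D : Instance S} where

    ∃'⋆-elim : ∀ xs {φ} σ → Sat D σ (∃'⋆ xs φ) →
      Σ (Var n → Dom) λ σ′ → (∀ v → v L.∉ xs → σ′ v ≡ σ v) × Sat D σ′ φ
    ∃'⋆-elim [] σ s = σ , (λ _ _ → refl) , s
    ∃'⋆-elim (x ∷ xs) σ (τ , τ-agree , s) with ∃'⋆-elim xs τ s
    ... | σ′ , σ′-agree , s′ =
      σ′ , (λ v v∉ → trans (σ′-agree v (v∉ ∘ there)) (τ-agree v (v∉ ∘ here))) , s′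

    ∃'⋆-intro : ∀ xs {φ} σ σ′ → (∀ v → v L.∉ xs → σ′ v ≡ σ v) → Sat D σ′ φ → Sat D σ (∃'⋆ xs φ)
    ∃'⋆-intro [] {φ} σ σ′ agree s = Sat-cong (λ v → agree v λ ()) φ s
    ∃'⋆-intro (x ∷ xs) σ σ′ agree s = τ , τ-agree , ∃'⋆-intro xs τ σ′ agree′ s
      where
      τ : Var n → Dom
      τ v with v ≟ᵛ x
      ... | yes _ = σ′ v
      ... | no _ = σ v
      τ-agree : ∀ v → v ≢ x → τ v ≡ σ v
      τ-agree v v≢x with v ≟ᵛ x
      ... | yes v≡x = ⊥-elim (v≢x v≡x)
      ... | no _ = refl
      agree′ : ∀ v → v L.∉ xs → σ′ v ≡ τ v
      agree′ v v∉ with v ≟ᵛ x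
      ... | yes _ = refl
      ... | no v≢x = agree v λ { (here v≡x) → v≢x v≡x ; (there v∈) → v∉ v∈ }

  Exec-∃'⋆ : ∀ xs {V W : Var n → Set} {φ} → (∀ v → V v → W v × v L.∉ xs) → Exec V φ → Exec W (∃'⋆ xs φ)
  Exec-∃'⋆ [] {φ = φ} V⊆W e = Exec-mono (λ v → proj₁ ∘ V⊆W v) φ e
  Exec-∃'⋆ (x ∷ xs) V⊆W e =
    Exec-∃'⋆ xs (λ v Vv → let (w , v∉) = V⊆W v Vv in (w , v∉ ∘ here) , v∉ ∘ there) e

  Free-∃'⋆ : ∀ xs {φ} v → Free v (∃'⋆ xs φ) ⇔ (Free v φ × v L.∉ xs)
  Free-∃'⋆ [] v = mk⇔ (_, λ ()) proj₁
  Free-∃'⋆ (x ∷ xs) v = mk⇔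
    (λ (f , v≢x) → let (f′ , v∉) = to (Free-∃'⋆ xs v) f in
      f′ , λ { (here v≡x) → v≢x v≡x ; (there v∈) → v∉ v∈ })
    (λ (f , v∉) → from (Free-∃'⋆ xs v) (f , v∉ ∘ there) , v∉ ∘ here)

  Occ-∃'⋆ : ∀ xs {φ} v → Occ v (∃'⋆ xs φ) → Occ v φ ⊎ v L.∈ xs
  Occ-∃'⋆ [] v o = inj₁ o
  Occ-∃'⋆ (x ∷ xs) v (inj₁ o) = Sum.map₂ there (Occ-∃'⋆ xs v o)
  Occ-∃'⋆ (x ∷ xs) v (inj₂ v≡x) = inj₂ (here v≡x)

  keep : Reg → Reg → List (Fin n) → Fm → Fm
  keep r s []       φ = φ
  keep r s (i ∷ is) φ = keep r s is φ ∧' eqv (reg r i) (reg s i)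

  frame : Reg → Reg → {P : Pred (Fin n) 0ℓ} → Decidable P → Fm → Fm
  frame r s P? = keep r s (filter (∁? P?) (allFin n))

  through : Reg → Fm → Fm → Fm
  through m φ ψ = ∃'⋆ (block m) (φ ∧' ψ)

  Exec-keep : ∀ {W : Var n → Set} r s is {φ} → (∀ i → W (reg r i)) → Exec W φ → Exec W (keep r s is φ)
  Exec-keep r s [] w e = e
  Exec-keep r s (i ∷ is) w e = Exec-keep r s is w e , inj₁ (inj₁ (w i))

  Free-keep : ∀ r s is {φ} v → Free v (keep r s is φ) → Free v φ ⊎ (v ∈ʳ r ⊎ v ∈ʳ s)
  Free-keep r s [] v f = inj₁ f
  Free-keep r s (i ∷ is) v (inj₁ f) = Free-keep r s is v f
  Free-keep r s (i ∷ is) v (inj₂ (inj₁ v≡)) = inj₂ (inj₁ (i , v≡))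
  Free-keep r s (i ∷ is) v (inj₂ (inj₂ v≡)) = inj₂ (inj₂ (i , v≡))

  Occ-keep : ∀ r s is {φ} v → Occ v (keep r s is φ) → Occ v φ ⊎ (v ∈ʳ r ⊎ v ∈ʳ s)
  Occ-keep r s [] v o = inj₁ o
  Occ-keep r s (i ∷ is) v (inj₁ o) = Occ-keep r s is v o
  Occ-keep r s (i ∷ is) v (inj₂ (inj₁ v≡)) = inj₂ (inj₁ (i , v≡))
  Occ-keep r s (i ∷ is) v (inj₂ (inj₂ v≡)) = inj₂ (inj₂ (i , v≡))

  Free-keep-base : ∀ r s is {φ} v → Free v φ → Free v (keep r s is φ)
  Free-keep-base r s [] v f = f
  Free-keep-base r s (i ∷ is) v f = inj₁ (Free-keep-base r s is v f)

  Free-keep-output : ∀ r s {is φ i} → i L.∈ is → Free (reg s i) (keep r s is φ)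
  Free-keep-output r s {_ ∷ is} (here refl) = inj₂ (inj₂ refl)
  Free-keep-output r s {_ ∷ is} (there i∈) = inj₁ (Free-keep-output r s i∈)

  Sat-keep : ∀ {D : Instance S} σ r s is {φ} →
    Sat D σ (keep r s is φ) ⇔ (Sat D σ φ × All (λ i → σ (reg r i) ≡ σ (reg s i)) is)
  Sat-keep σ r s [] = mk⇔ (_, []) proj₁
  Sat-keep σ r s (i ∷ is) = mk⇔
    (λ (k , c) → let (sφ , cs) = to (Sat-keep σ r s is) k in sφ , c ∷ cs)
    (λ { (sφ , c ∷ cs) → from (Sat-keep σ r s is) (sφ , cs) , c })

  record IOFormula (r s : Reg) (φ : Fm) : Set where
    field
      executable  : Exec (_∈ʳ r) φ
      free-io     : ∀ v → Free v φ → v ∈ʳ r ⊎ v ∈ʳ s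
      free-output : ∀ i → Free (reg s i) φ
      occ-reg     : ∀ v → Occ v φ → RegVar v
  open IOFormula

  frame-io : ∀ r s {P} (P? : Decidable P) {b} → Exec (_∈ʳ r) b →
    (∀ v → Free v b → v ∈ʳ r ⊎ v ∈ʳ s) → (∀ i → P i → Free (reg s i) b) →
    (∀ v → Occ v b → RegVar v) → IOFormula r s (frame r s P? b)
  frame-io r s P? {b} exec free output occ = record
    { executable  = Exec-keep r s is (λ i → i , refl) exec
    ; free-io     = λ v f → [ free v , id ]′ (Free-keep r s is v f)
    ; free-output = free-output′
    ; occ-reg     = λ v o → [ occ v , [ (r ,_) , (s ,_) ]′ ]′ (Occ-keep r s is v o)
    }
    where
    is = filter (∁? P?) (allFin n)
    free-output′ : ∀ i → Free (reg s i) (frame r s P? b)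
    free-output′ i with P? i
    ... | yes p = Free-keep-base r s is _ (output i p)
    ... | no ¬p = Free-keep-output r s (∈-filter⁺ (∁? P?) (∈-allFin i) ¬p)

  through-io : ∀ {r m s φ ψ} → m ≢ r → m ≢ s → IOFormula r m φ → IOFormula m s ψ →
    IOFormula r s (through m φ ψ)
  through-io {r} {m} {s} {φ} {ψ} m≢r m≢s ioφ ioψ = record
    { executable  = Exec-∃'⋆ (block m) (λ v ∈r → ∈r , ∉-block m≢r ∈r)
                      (executable ioφ , Exec-mono inputs-bound ψ (executable ioψ))
    ; free-io     = λ v f → uncurry free-outside (to (Free-∃'⋆ (block m) v) f)
    ; free-output = λ i → from (Free-∃'⋆ (block m) (reg s i))
                      (inj₂ (free-output ioψ i) , ∉-block m≢s (i , refl))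
    ; occ-reg     = λ v o → [ [ occ-reg ioφ v , occ-reg ioψ v ]′ , (λ v∈ → m , ∈-tabulate⁻ v∈) ]′
                      (Occ-∃'⋆ (block m) v o)
    }
    where
    inputs-bound : ∀ v → v ∈ʳ m → v ∈ʳ r ⊎ Free v φ
    inputs-bound v (i , refl) = inj₂ (free-output ioφ i)
    free-outside : ∀ {v} → Free v (φ ∧' ψ) → v L.∉ block m → v ∈ʳ r ⊎ v ∈ʳ s
    free-outside {v} (inj₁ f) v∉ = Sum.map₂ (⊥-elim ∘ v∉ ∘ ∈-block⁺ m) (free-io ioφ v f)
    free-outside {v} (inj₂ f) v∉ = Sum.map₁ (⊥-elim ∘ v∉ ∘ ∈-block⁺ m) (free-io ioψ v f)

  ∨-io : ∀ {r s φ ψ} → IOFormula r s φ → IOFormula r s ψ → IOFormula r s (φ ∨' ψ)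
  ∨-io {r} {s} {φ} {ψ} ioφ ioψ = record
    { executable  = executable ioφ , executable ioψ , only-inputs ioφ ioψ , only-inputs ioψ ioφ
    ; free-io     = λ v → [ free-io ioφ v , free-io ioψ v ]′
    ; free-output = inj₁ ∘ free-output ioφ
    ; occ-reg     = λ v → [ occ-reg ioφ v , occ-reg ioψ v ]′
    }
    where
    only-inputs : ∀ {χ ξ} → IOFormula r s χ → IOFormula r s ξ → ∀ v → Free v χ → ¬ Free v ξ → v ∈ʳ r
    only-inputs ioχ ioξ v f ¬f with free-io ioχ v f
    ... | inj₁ ∈r = ∈r
    ... | inj₂ (i , refl) = ⊥-elim (¬f (free-output ioξ i))

  ∧¬-io : ∀ {r s φ ψ} → IOFormula r s φ → IOFormula r s ψ → IOFormula r s (φ ∧' ¬' ψ)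
  ∧¬-io {r} {s} {φ} {ψ} ioφ ioψ = record
    { executable  = executable ioφ , Exec-mono (λ _ → inj₁) ψ (executable ioψ) , covered
    ; free-io     = λ v → [ free-io ioφ v , free-io ioψ v ]′
    ; free-output = inj₁ ∘ free-output ioφ
    ; occ-reg     = λ v → [ occ-reg ioφ v , occ-reg ioψ v ]′
    }
    where
    covered : ∀ v → Free v ψ → v ∈ʳ r ⊎ Free v φ
    covered v f with free-io ioψ v f
    ... | inj₁ ∈r = inj₁ ∈r
    ... | inj₂ (i , refl) = inj₂ (free-output ioφ i)

  tr : FLIF S n → Reg → Reg → Fm
  tr (rel R xs ys) r s = frame r s (_∈? ys) (rel R (V.map (reg r) xs) (V.map (reg s) ys))
  tr (eqv x y)     r s = frame r s ∅? (eqv (reg r x) (reg r y))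
  tr (eqc x c)     r s = frame r s ∅? (eqc (reg r x) c)
  tr (asgv x y)    r s = frame r s (_≟ x) (eqv (reg s x) (reg r y))
  tr (asgc x c)    r s = frame r s (_≟ x) (eqc (reg s x) c)
  tr (α ⨾ β)       r s = through (other r s) (tr α r (other r s)) (tr β (other r s) s)
  tr (α ∪ β)       r s = tr α r s ∨' tr β r s
  tr (α ─ β)       r s = tr α r s ∧' ¬' (tr β r s)

  tr-io : ∀ α r s → IOFormula r s (tr α r s)
  tr-io (rel R xs ys) r s = frame-io r s (_∈? ys) (λ _ → ∈-map-reg r)
    (λ _ → Sum.map (∈-map-reg r) (∈-map-reg s)) (λ _ → inj₂ ∘ ∈-map⁺ (reg s))
    (λ _ → [ (r ,_) ∘ ∈-map-reg r , (s ,_) ∘ ∈-map-reg s ]′)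
  tr-io (eqv x y) r s = frame-io r s ∅? (inj₁ (x , refl))
    (λ { _ (inj₁ refl) → inj₁ (x , refl) ; _ (inj₂ refl) → inj₁ (y , refl) }) (λ _ ())
    (λ { _ (inj₁ refl) → r , x , refl ; _ (inj₂ refl) → r , y , refl })
  tr-io (eqc x c) r s = frame-io r s ∅? tt
    (λ { _ refl → inj₁ (x , refl) }) (λ _ ()) (λ { _ refl → r , x , refl })
  tr-io (asgv x y) r s = frame-io r s (_≟ x) (inj₂ (y , refl))
    (λ { _ (inj₁ refl) → inj₂ (x , refl) ; _ (inj₂ refl) → inj₁ (y , refl) }) (λ { _ refl → inj₁ refl })
    (λ { _ (inj₁ refl) → s , x , refl ; _ (inj₂ refl) → r , y , refl })
  tr-io (asgc x c) r s = frame-io r s (_≟ x) tt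
    (λ { _ refl → inj₂ (x , refl) }) (λ { _ refl → refl }) (λ { _ refl → s , x , refl })
  tr-io (α ⨾ β) r s = through-io (proj₁ (other-fresh r s)) (proj₂ (other-fresh r s))
    (tr-io α r (other r s)) (tr-io β (other r s) s)
  tr-io (α ∪ β) r s = ∨-io (tr-io α r s) (tr-io β r s)
  tr-io (α ─ β) r s = ∧¬-io (tr-io α r s) (tr-io β r s)

  record Defines (D : Instance S) (ρ : Val n → Val n → Set) (r s : Reg) (φ : Fm) : Set where
    constructor defines
    field
      sat⇔ : ∀ ν₁ ν₂ σ → (∀ i → σ (reg r i) ≡ lookup ν₁ i) → (∀ i → σ (reg s i) ≡ lookup ν₂ i) →
        ρ ν₁ ν₂ ⇔ Sat D σ φ
  open Defines

  module _ {D : Instance S} where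

    Defines-resp : ∀ {ρ ρ′ r s φ} → (∀ ν₁ ν₂ → ρ ν₁ ν₂ ⇔ ρ′ ν₁ ν₂) → Defines D ρ′ r s φ → Defines D ρ r s φ
    Defines-resp ρ⇔ρ′ d = defines λ ν₁ ν₂ σ hr hs → ⇔-trans (ρ⇔ρ′ ν₁ ν₂) (sat⇔ d ν₁ ν₂ σ hr hs)

    rel-defines : ∀ R (xs : V.Vec (Fin n) (iar S R)) (ys : V.Vec (Fin n) (oar S R)) r s →
      Defines D (λ ν₁ ν₂ → D R (V.map (lookup ν₁) xs V.++ V.map (lookup ν₂) ys)) r s
        (rel R (V.map (reg r) xs) (V.map (reg s) ys))
    rel-defines R xs ys r s = defines λ ν₁ ν₂ σ hr hs →
      let args≡ = cong₂ V._++_ (map-∘-cong hr xs) (map-∘-cong hs ys)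
      in mk⇔ (subst (D R) (sym args≡)) (subst (D R) args≡)

    frame-defines : ∀ {ρ r s b} {P} (P? : Decidable P) → Defines D ρ r s b →
      Defines D (λ ν₁ ν₂ → ρ ν₁ ν₂ × Unchanged P ν₁ ν₂) r s (frame r s P? b)
    frame-defines {r = r} {s} {P = P} P? db = defines λ ν₁ ν₂ σ hr hs →
      ⇔-trans (sat⇔ db ν₁ ν₂ σ hr hs ×-⇔ unchanged⇔copied ν₁ ν₂ σ hr hs)
              (⇔-sym (⇔-trans (Sat-keep σ r s _) (⇔-refl ×-⇔ All-filter-∁-allFin P?)))
      where
      unchanged⇔copied : ∀ ν₁ ν₂ σ → (∀ i → σ (reg r i) ≡ lookup ν₁ i) → (∀ i → σ (reg s i) ≡ lookup ν₂ i) →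
        Unchanged P ν₁ ν₂ ⇔ (∀ i → ¬ P i → σ (reg r i) ≡ σ (reg s i))
      unchanged⇔copied _ _ _ hr hs = mk⇔ (λ h i ¬p → from (≡⇔≡ (hr i) (hs i)) (h i ¬p))
                             (λ h i ¬p → to (≡⇔≡ (hr i) (hs i)) (h i ¬p))

    through-defines : ∀ {ρ ρ′ r m s φ ψ} → m ≢ r → m ≢ s → Defines D ρ r m φ → Defines D ρ′ m s ψ →
      Defines D (λ ν₁ ν₂ → Σ (Val n) λ ν → ρ ν₁ ν × ρ′ ν ν₂) r s (through m φ ψ)
    through-defines {ρ} {ρ′} {r} {m} {s} {φ} {ψ} m≢r m≢s dφ dψ = defines λ ν₁ ν₂ σ hr hs → mk⇔ (intro hr hs) (elim hr hs)
      where
      intro : ∀ {ν₁ ν₂ σ} → (∀ i → σ (reg r i) ≡ lookup ν₁ i) → (∀ i → σ (reg s i) ≡ lookup ν₂ i) →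
        (Σ (Val n) λ ν → ρ ν₁ ν × ρ′ ν ν₂) → Sat D σ (through m φ ψ)
      intro {ν₁} {ν₂} {σ} hr hs (ν , a , b) =
        ∃'⋆-intro (block m) σ σ′ (λ v v∉ → overwrite-other m ν σ (v∉ ∘ ∈-block⁺ m))
          (to (sat⇔ dφ ν₁ ν σ′ hr′ hm) a , to (sat⇔ dψ ν ν₂ σ′ hm hs′) b)
        where
        σ′ = overwrite m ν σ
        hm = overwrite-reg m ν σ
        hr′ = λ i → trans (overwrite-other m ν σ (∉ʳ-other m≢r (i , refl))) (hr i)
        hs′ = λ i → trans (overwrite-other m ν σ (∉ʳ-other m≢s (i , refl))) (hs i)
      elim : ∀ {ν₁ ν₂ σ} → (∀ i → σ (reg r i) ≡ lookup ν₁ i) → (∀ i → σ (reg s i) ≡ lookup ν₂ i) →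
        Sat D σ (through m φ ψ) → Σ (Val n) λ ν → ρ ν₁ ν × ρ′ ν ν₂
      elim {ν₁} {ν₂} {σ} hr hs sat with ∃'⋆-elim (block m) σ sat
      ... | σ′ , agree , sφ , sψ = ν , from (sat⇔ dφ ν₁ ν σ′ hr′ hm) sφ , from (sat⇔ dψ ν ν₂ σ′ hm hs′) sψ
        where
        ν = tabulate (σ′ ∘ reg m)
        hm = λ i → sym (lookup∘tabulate (σ′ ∘ reg m) i)
        hr′ = λ i → trans (agree (reg r i) (∉-block m≢r (i , refl))) (hr i)
        hs′ = λ i → trans (agree (reg s i) (∉-block m≢s (i , refl))) (hs i)

    ∨-defines : ∀ {ρ ρ′ r s φ ψ} → Defines D ρ r s φ → Defines D ρ′ r s ψ →
      Defines D (λ ν₁ ν₂ → ρ ν₁ ν₂ ⊎ ρ′ ν₁ ν₂) r s (φ ∨' ψ)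
    ∨-defines dφ dψ = defines λ ν₁ ν₂ σ hr hs → sat⇔ dφ ν₁ ν₂ σ hr hs ⊎-⇔ sat⇔ dψ ν₁ ν₂ σ hr hs

    ∧¬-defines : ∀ {ρ ρ′ r s φ ψ} → Defines D ρ r s φ → Defines D ρ′ r s ψ →
      Defines D (λ ν₁ ν₂ → ρ ν₁ ν₂ × ¬ ρ′ ν₁ ν₂) r s (φ ∧' ¬' ψ)
    ∧¬-defines dφ dψ = defines λ ν₁ ν₂ σ hr hs → sat⇔ dφ ν₁ ν₂ σ hr hs ×-⇔ ¬-cong-⇔ (sat⇔ dψ ν₁ ν₂ σ hr hs)

    tr-defines : ∀ α r s → Defines D (⟦ α ⟧ D) r s (tr α r s)
    tr-defines (rel R xs ys) r s = frame-defines (_∈? ys) (rel-defines R xs ys r s)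
    tr-defines (eqv x y) r s = Defines-resp (λ _ _ → ≡×⇔×Unchanged-∅)
      (frame-defines ∅? (defines λ _ _ _ hr _ → ≡⇔≡ (sym (hr x)) (sym (hr y))))
    tr-defines (eqc x c) r s = Defines-resp (λ _ _ → ≡×⇔×Unchanged-∅)
      (frame-defines ∅? (defines λ _ _ _ hr _ → ≡⇔≡ (sym (hr x)) refl))
    tr-defines (asgv x y) r s = Defines-resp (λ _ _ → ≡-update⇔)
      (frame-defines (_≟ x) (defines λ _ _ _ hr hs → ≡⇔≡ (sym (hs x)) (sym (hr y))))
    tr-defines (asgc x c) r s = Defines-resp (λ _ _ → ≡-update⇔)
      (frame-defines (_≟ x) (defines λ _ _ _ _ hs → ≡⇔≡ (sym (hs x)) refl))
    tr-defines (α ⨾ β) r s = through-defines (proj₁ (other-fresh r s)) (proj₂ (other-fresh r s))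
      (tr-defines α r (other r s)) (tr-defines β (other r s) s)
    tr-defines (α ∪ β) r s = ∨-defines (tr-defines α r s) (tr-defines β r s)
    tr-defines (α ─ β) r s = ∧¬-defines (tr-defines α r s) (tr-defines β r s)

proposition3p7 : (S : Schema) (n : ℕ) (α : FLIF S n) →
    Σ (Formula S n) λ φ →
      Exec IsX φ ×
      UsesAtMost (3 * n) φ ×
      (∀ v → Free v φ → IsXY v) ×
      (∀ (D : Instance S) (ν₁ ν₂ : Val n) (σ : Var n → Dom) →
        (∀ i → σ (xv i) ≡ lookup ν₁ i) →
        (∀ i → σ (yv i) ≡ lookup ν₂ i) →
        (⟦ α ⟧ D ν₁ ν₂ ⇔ Sat D σ φ))
proposition3p7 S n α =
  tr α X Y ,
  Exec-mono (λ { _ (_ , refl) → tt }) (tr α X Y) executable ,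
  (regVars , ≤-reflexive (length-regVars {n}) , λ v → ∈-regVars ∘ occ-reg v) ,
  (λ v → [ (λ { (_ , refl) → tt }) , (λ { (_ , refl) → tt }) ]′ ∘ free-io v) ,
  λ D → Defines.sat⇔ (tr-defines {D = D} α X Y)
  where
  open IOFormula (tr-io α X Y)
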